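{- Let $i\geq 1$. The set $S_i=\{C(n) : 2^{i-1}\leq n\leq 2^i,\ n \text{ even}\}$ is an interval of $\mathbb{N}$ (i.e. a set of consecutive integers).
   Context: Let $\phi$ be Euler's totient function and $g(n)=n-\phi(n)$ for $n\geq 1$ (the move map of the game \textsc{nontotient}); write $g^i$ for the $i$-fold iterate. For $n\geq 1$, $C(n)$ denotes the least $i\geq 0$ with $g^i(n)=1$ (so $C(1)=0$, $C(2)=1$, $C(4)=2$). -}

module Defs where

open import Data.Nat using (ℕ; zero; suc; _+_; _*_; _∸_; _^_; _≤_; _<_)
open import Data.Nat.GCD using (gcd)
open import Data.Nat.Properties using (_≟_)
open import Data.List using (List; length; filter)
open import Data.List.Base using (upTo)
open import Data.Product using (Σ; _×_; ∃-syntax)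
open import Relation.Binary.PropositionalEquality using (_≡_)
open import Relation.Nullary using (¬_)

-- Euler's totient: φ(n) = #{ k : 1 ≤ k ≤ n, gcd(k,n) = 1 }  (φ 0 = 0, φ 1 = 1)
φ : ℕ → ℕ
φ n = length (filter (λ k → gcd (suc k) n ≟ 1) (upTo n))

g : ℕ → ℕ
g n = n ∸ φ n

iter : ℕ → ℕ → ℕ
iter zero    n = n
iter (suc i) n = g (iter i n)

-- IsC n c : c = C(n), the least i ≥ 0 with g^i(n) = 1
IsC : ℕ → ℕ → Set
IsC n c = (iter c n ≡ 1) × (∀ j → j < c → ¬ (iter j n ≡ 1))

InS : ℕ → ℕ → Set
InS i m = ∃[ n ] ((2 ^ (i ∸ 1) ≤ n) × (n ≤ 2 ^ i) × (∃[ k ] n ≡ 2 * k) × IsC n m)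

IsInterval : (ℕ → Set) → Set
IsInterval P = ∀ a b c → P a → P b → a ≤ c → c ≤ b → P c

-- For even m, φ(2m) = 2φ(m), so g(2m) = 2g(m); and for even y ≥ 2, g(y) is 1 or
-- even, with y/2 ≤ g(y) < y.  Hence C(2^h y) = C(y) + h and n ≤ 2^C(n) for such n,
-- so min S_i = i − 1, attained at 2^(i−1).  The other values are met by walking
-- down from a witness 2^h y (initially h = 0) of a larger value: replace y by g(y),
-- and raise h by one whenever 2^h g(y) would drop below 2^(i−1).  The point stays
-- in [2^(i−1), 2^i] and C drops by at most one per step, until y = 1.
module Submission where

open import Defs
open import Data.Nat
open import Data.Nat.Properties
open import Data.Nat.Divisibility
open import Data.Nat.GCD using (gcd; gcd-zeroˡ)
open import Data.Nat.Coprimality using (Coprime; coprime-+; coprime-divisor; coprime⇒gcd≡1; gcd≡1⇒coprime)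
open import Data.Nat.Tactic.RingSolver using (solve-∀)
open import Data.Bool using (Bool; true; false)
open import Data.List using (length; filter; applyUpTo)
open import Data.Product using (∃-syntax; _,_)
open import Data.Sum using (_⊎_; inj₁; inj₂)
open import Function using (_∘_; _⇔_; mk⇔; Equivalence)
open import Level using (0ℓ)
open import Relation.Nullary using (does; yes; no; contradiction)
open import Relation.Nullary.Decidable using (dec-true; dec-false; does-⇔)
open import Relation.Unary using (Pred; Decidable)
open import Relation.Binary.PropositionalEquality
open import Relation.Binary.Definitions using (tri<; tri≈; tri>)

indicator : Bool → ℕ
indicator true  = 1
indicator false = 0

indicator≤1 : ∀ b → indicator b ≤ 1
indicator≤1 true  = ≤-refl
indicator≤1 false = z≤n

count : (ℕ → Bool) → ℕ → ℕ
count f zero    = 0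
count f (suc n) = indicator (f 0) + count (f ∘ suc) n

length-filter-applyUpTo : ∀ {P : Pred ℕ 0ℓ} (P? : Decidable P) h n →
  length (filter P? (applyUpTo h n)) ≡ count (λ k → does (P? (h k))) n
length-filter-applyUpTo P? h zero = refl
length-filter-applyUpTo P? h (suc n) with does (P? (h 0))
... | true  = cong suc (length-filter-applyUpTo P? (h ∘ suc) n)
... | false = length-filter-applyUpTo P? (h ∘ suc) n

count-cong : ∀ {f f′} n → (∀ k → k < n → f k ≡ f′ k) → count f n ≡ count f′ n
count-cong zero    eq = refl
count-cong (suc n) eq =
  cong₂ _+_ (cong indicator (eq 0 z<s)) (count-cong n (λ k k<n → eq (suc k) (s<s k<n)))

count-+ : ∀ f m n → count f (m + n) ≡ count f m + count (λ k → f (m + k)) n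
count-+ f zero    n = refl
count-+ f (suc m) n =
  trans (cong (indicator (f 0) +_) (count-+ (f ∘ suc) m n)) (sym (+-assoc (indicator (f 0)) _ _))

count-snoc : ∀ f n → count f (suc n) ≡ count f n + indicator (f n)
count-snoc f zero    = +-identityʳ _
count-snoc f (suc n) =
  trans (cong (indicator (f 0) +_) (count-snoc (f ∘ suc) n)) (sym (+-assoc (indicator (f 0)) _ _))

count-reverse : ∀ f n → count f n ≡ count (λ k → f (n ∸ suc k)) n
count-reverse f zero    = refl
count-reverse f (suc n) = begin
  indicator (f 0) + count (f ∘ suc) n                    ≡⟨ cong (indicator (f 0) +_) (count-reverse (f ∘ suc) n) ⟩
  indicator (f 0) + count (λ k → f (suc (n ∸ suc k))) n  ≡⟨ +-comm (indicator (f 0)) _ ⟩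
  count (λ k → f (suc (n ∸ suc k))) n + indicator (f 0)  ≡⟨ cong₂ _+_ (count-cong n (λ k k<n → cong f (sym (+-∸-assoc 1 k<n))))
                                                                      (cong (indicator ∘ f) (sym (n∸n≡0 n))) ⟩
  count (λ k → f (n ∸ k)) n + indicator (f (n ∸ n))      ≡⟨ count-snoc (λ k → f (suc n ∸ suc k)) n ⟨
  count (λ k → f (suc n ∸ suc k)) (suc n)                ∎
  where open ≡-Reasoning

count-≤-half : ∀ f m → (∀ j → f (suc (j * 2)) ≡ false) → count f (m * 2) ≤ m
count-≤-half f zero    odd-false = z≤n
count-≤-half f (suc m) odd-false rewrite odd-false 0 =
  +-mono-≤ (indicator≤1 (f 0)) (count-≤-half (f ∘ suc ∘ suc) m (odd-false ∘ suc))

coprimeᵇ : ℕ → ℕ → Bool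
coprimeᵇ k n = does (gcd k n ≟ 1)

φ≡count : ∀ n → φ n ≡ count (λ k → coprimeᵇ (suc k) n) n
φ≡count n = length-filter-applyUpTo (λ k → gcd (suc k) n ≟ 1) (λ k → k) n

coprimeᵇ-cong : ∀ k n k′ n′ → Coprime k n ⇔ Coprime k′ n′ → coprimeᵇ k n ≡ coprimeᵇ k′ n′
coprimeᵇ-cong k n k′ n′ k⊥n⇔k′⊥n′ = does-⇔
  (mk⇔ (coprime⇒gcd≡1 {k′} {n′} ∘ Equivalence.to k⊥n⇔k′⊥n′ ∘ gcd≡1⇒coprime {k} {n})
       (coprime⇒gcd≡1 {k} {n} ∘ Equivalence.from k⊥n⇔k′⊥n′ ∘ gcd≡1⇒coprime {k′} {n′}))
  (gcd k n ≟ 1) (gcd k′ n′ ≟ 1)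

coprimeᵇ-false : ∀ {d} k n → d ∣ k → d ∣ n → d ≢ 1 → coprimeᵇ k n ≡ false
coprimeᵇ-false k n d∣k d∣n d≢1 = dec-false (gcd k n ≟ 1) (λ gcd≡1 → d≢1 (gcd≡1⇒coprime gcd≡1 (d∣k , d∣n)))

coprime-+⇔ : ∀ {k n} → Coprime (n + k) n ⇔ Coprime k n
coprime-+⇔ = mk⇔ (λ c {_} (d∣k , d∣n) → c (∣m∣n⇒∣m+n d∣n d∣k , d∣n)) coprime-+

coprime-∸ : ∀ {k n} → k ≤ n → Coprime k n → Coprime (n ∸ k) n
coprime-∸ k≤n c (d∣n∸k , d∣n) = c (∣m+n∣m⇒∣n (subst (_ ∣_) (sym (m∸n+n≡m k≤n)) d∣n) d∣n∸k , d∣n)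

coprime-∸⇔ : ∀ {k n} → k ≤ n → Coprime (n ∸ k) n ⇔ Coprime k n
coprime-∸⇔ {k} {n} k≤n = mk⇔
  (subst (λ x → Coprime x n) (m∸[m∸n]≡n k≤n) ∘ coprime-∸ (m∸n≤m n k))
  (coprime-∸ k≤n)

coprime-2*⇔ : ∀ {k m} → 2 ∣ m → Coprime k (2 * m) ⇔ Coprime k m
coprime-2*⇔ {k} {m} 2∣m = mk⇔
  (λ c {_} (d∣k , d∣m) → c (d∣k , ∣n⇒∣m*n 2 d∣m))
  (λ c {_} (d∣k , d∣2m) → c (d∣k , ∣-trans (d∣2 c d∣k d∣2m) 2∣m))
  where
  -- d is coprime to m, as a common divisor of d and m also divides k.
  d∣2 : ∀ {d} → Coprime k m → d ∣ k → d ∣ 2 * m → d ∣ 2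
  d∣2 {d} c d∣k d∣2m = coprime-divisor {d} {m} {2}
    (λ {_} (e∣d , e∣m) → c (∣-trans e∣d d∣k , e∣m))
    (subst (d ∣_) (*-comm 2 m) d∣2m)

coprimeᵇ-+ : ∀ k n → coprimeᵇ (n + k) n ≡ coprimeᵇ k n
coprimeᵇ-+ k n = coprimeᵇ-cong (n + k) n k n coprime-+⇔

coprimeᵇ-∸ : ∀ {k n} → k ≤ n → coprimeᵇ (n ∸ k) n ≡ coprimeᵇ k n
coprimeᵇ-∸ {k} {n} k≤n = coprimeᵇ-cong (n ∸ k) n k n (coprime-∸⇔ k≤n)

coprimeᵇ-2* : ∀ k {m} → 2 ∣ m → coprimeᵇ k (2 * m) ≡ coprimeᵇ k m
coprimeᵇ-2* k {m} 2∣m = coprimeᵇ-cong k (2 * m) k m (coprime-2*⇔ 2∣m)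

1≤φ : ∀ n → 1 ≤ φ (suc n)
1≤φ n = subst (1 ≤_) (sym (φ≡count (suc n))) (≤-trans 1≤indicator (m≤m+n _ _))
  where
  1≤indicator : 1 ≤ indicator (coprimeᵇ 1 (suc n))
  1≤indicator = ≤-reflexive (cong indicator (sym (dec-true (gcd 1 (suc n) ≟ 1) (gcd-zeroˡ (suc n)))))

φ[2m]≡2φ[m] : ∀ m → 2 ∣ m → φ (2 * m) ≡ 2 * φ m
φ[2m]≡2φ[m] m 2∣m = begin
  φ (2 * m)                          ≡⟨ φ≡count (2 * m) ⟩
  count f (2 * m)                    ≡⟨ cong (count f) (cong (m +_) (+-identityʳ m)) ⟩
  count f (m + m)                    ≡⟨ count-+ f m m ⟩
  count f m + count (f ∘ (m +_)) m   ≡⟨ cong₂ _+_ (count-cong m (λ k _ → coprimeᵇ-2* (suc k) 2∣m))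
                                                  (count-cong m (λ k _ → upper-half k)) ⟩
  φ′ + φ′                            ≡⟨ cong (φ′ +_) (sym (+-identityʳ φ′)) ⟩
  2 * φ′                             ≡⟨ cong (2 *_) (φ≡count m) ⟨
  2 * φ m                            ∎
  where
  open ≡-Reasoning
  f : ℕ → Bool
  f k = coprimeᵇ (suc k) (2 * m)
  φ′ : ℕ
  φ′ = count (λ k → coprimeᵇ (suc k) m) m
  upper-half : ∀ k → f (m + k) ≡ coprimeᵇ (suc k) m
  upper-half k = begin
    coprimeᵇ (suc (m + k)) (2 * m)  ≡⟨ coprimeᵇ-2* (suc (m + k)) 2∣m ⟩
    coprimeᵇ (suc (m + k)) m        ≡⟨ cong (λ x → coprimeᵇ x m) (+-suc m k) ⟨
    coprimeᵇ (m + suc k) m          ≡⟨ coprimeᵇ-+ (suc k) m ⟩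
    coprimeᵇ (suc k) m              ∎

φ[2m]≤m : ∀ m → φ (2 * m) ≤ m
φ[2m]≤m m = subst (_≤ m) (sym (trans (φ≡count (2 * m)) (cong (count f) (*-comm 2 m))))
  (count-≤-half f m (λ j → coprimeᵇ-false (suc j * 2) (2 * m) (n∣m*n (suc j)) (m∣m*n m) (λ ())))
  where
  f : ℕ → Bool
  f k = coprimeᵇ (suc k) (2 * m)

-- k ↦ 2m − k pairs up the totatives of 2m; the fixed point m is not one of them.
2∣φ[2m] : ∀ m → 2 ≤ m → 2 ∣ φ (2 * m)
2∣φ[2m] (suc zero) (s≤s ())
2∣φ[2m] m@(suc r@(suc _)) _ = divides (count f r) (begin
  φ n                                ≡⟨ φ≡count n ⟩
  count f n                          ≡⟨ cong (count f) (cong (m +_) (+-identityʳ m)) ⟩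
  count f (m + m)                    ≡⟨ count-+ f m m ⟩
  count f m + count h m              ≡⟨ cong₂ _+_ (count-snoc f r) (count-snoc h r) ⟩
  (count f r + indicator (f r)) + (count h r + indicator (h r))
                                     ≡⟨ cong₂ (λ x y → (count f r + indicator x) + (count h r + indicator y))
                                              m-not-coprime n-not-coprime ⟩
  (count f r + 0) + (count h r + 0)  ≡⟨ cong₂ _+_ (+-identityʳ (count f r)) (+-identityʳ (count h r)) ⟩
  count f r + count h r              ≡⟨ cong (count f r +_) (trans (count-reverse h r) (count-cong r reflect)) ⟩
  count f r + count f r              ≡⟨ cong (count f r +_) (+-identityʳ (count f r)) ⟨
  2 * count f r                      ≡⟨ *-comm 2 (count f r) ⟩
  count f r * 2                      ∎)
  where
  open ≡-Reasoning
  n : ℕ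
  n = 2 * m
  f : ℕ → Bool
  f k = coprimeᵇ (suc k) n
  h : ℕ → Bool
  h k = f (m + k)
  m-not-coprime : f r ≡ false
  m-not-coprime = coprimeᵇ-false m n ∣-refl (n∣m*n 2) (λ ())
  n-not-coprime : h r ≡ false
  n-not-coprime = coprimeᵇ-false (suc (m + r)) n
    (∣-reflexive (trans (cong (m +_) (+-identityʳ m)) (+-suc m r))) ∣-refl (λ ())
  mirror : ∀ k → k < r → suc (m + (r ∸ suc k)) ≡ n ∸ suc k
  mirror k k<r = begin
    suc (m + (r ∸ suc k))  ≡⟨ +-suc m (r ∸ suc k) ⟨
    m + suc (r ∸ suc k)    ≡⟨ cong (m +_) (+-∸-assoc 1 k<r) ⟨
    m + (m ∸ suc k)        ≡⟨ +-∸-assoc m (<⇒≤ (s<s k<r)) ⟨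
    (m + m) ∸ suc k        ≡⟨ cong (λ x → (m + x) ∸ suc k) (+-identityʳ m) ⟨
    n ∸ suc k              ∎
  reflect : ∀ k → k < r → h (r ∸ suc k) ≡ f k
  reflect k k<r = trans (cong (λ x → coprimeᵇ x n) (mirror k k<r))
    (coprimeᵇ-∸ (≤-trans (<⇒≤ (s<s k<r)) (m≤m+n m (m + 0))))

g[2m]≡2g[m] : ∀ m → 2 ∣ m → g (2 * m) ≡ 2 * g m
g[2m]≡2g[m] m 2∣m = trans (cong (2 * m ∸_) (φ[2m]≡2φ[m] m 2∣m)) (sym (*-distribˡ-∸ 2 m (φ m)))

m≤g[2m] : ∀ m → m ≤ g (2 * m)
m≤g[2m] m = subst (_≤ g (2 * m)) 2m∸m≡m (∸-monoʳ-≤ (2 * m) (φ[2m]≤m m))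
  where
  2m∸m≡m : 2 * m ∸ m ≡ m
  2m∸m≡m = trans (cong (_∸ m) (cong (m +_) (+-identityʳ m))) (m+n∸m≡n m m)

g[2m]<2m : ∀ m → g (2 * suc m) < 2 * suc m
g[2m]<2m m = ∸-monoʳ-< (1≤φ (m + suc (m + 0))) (≤-trans (φ[2m]≤m (suc m)) (m≤m+n (suc m) (suc m + 0)))

2*≢1 : ∀ k → 2 * k ≢ 1
2*≢1 zero    ()
2*≢1 (suc k) eq = m+1+n≢0 k (suc-injective eq)

2^-cancel-≤ : ∀ {m n} → 2 ^ m ≤ 2 ^ n → m ≤ n
2^-cancel-≤ {m} {n} 2^m≤2^n with m ≤? n
... | yes m≤n = m≤n
... | no  m≰n = contradiction 2^m≤2^n (<⇒≱ (^-monoʳ-< 2 (s≤s (s≤s z≤n)) (≰⇒> m≰n)))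

2^suc-* : ∀ h y → 2 ^ suc h * y ≡ 2 * (2 ^ h * y)
2^suc-* h y = *-assoc 2 (2 ^ h) y

m*[2*n]≡2*m*n : ∀ m n → m * (2 * n) ≡ 2 * m * n
m*[2*n]≡2*m*n = solve-∀

OneOrEven : ℕ → Set
OneOrEven y = y ≡ 1 ⊎ ∃[ k ] y ≡ 2 * suc k

even⇒OneOrEven : ∀ {y} k → y ≡ 2 * k → 1 ≤ y → OneOrEven y
even⇒OneOrEven zero    refl ()
even⇒OneOrEven (suc k) y≡2k _ = inj₂ (k , y≡2k)

OneOrEven⇒even : ∀ {y} → OneOrEven y → 2 ≤ y → ∃[ k ] y ≡ 2 * k
OneOrEven⇒even (inj₁ refl)       (s≤s ())
OneOrEven⇒even (inj₂ (k , y≡2k)) _ = suc k , y≡2k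

OneOrEven-2* : ∀ {y} → OneOrEven y → OneOrEven (2 * y)
OneOrEven-2* (inj₁ refl)       = inj₂ (0 , refl)
OneOrEven-2* (inj₂ (k , refl)) = inj₂ (k + suc (k + 0) , refl)

OneOrEven-2^* : ∀ h {y} → OneOrEven y → OneOrEven (2 ^ h * y)
OneOrEven-2^* zero    oy = subst OneOrEven (sym (*-identityˡ _)) oy
OneOrEven-2^* (suc h) oy = subst OneOrEven (sym (2^suc-* h _)) (OneOrEven-2* (OneOrEven-2^* h oy))

g-OneOrEven : ∀ m → OneOrEven (g (2 * suc m))
g-OneOrEven zero    = inj₁ refl
g-OneOrEven (suc m) with 2∣φ[2m] (2 + m) (s≤s (s≤s z≤n))
... | divides t φ≡t*2 = even⇒OneOrEven (2 + m ∸ t) g≡2[m∸t] (≤-trans (s≤s z≤n) (m≤g[2m] (2 + m)))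
  where
  g≡2[m∸t] : g (2 * (2 + m)) ≡ 2 * (2 + m ∸ t)
  g≡2[m∸t] = trans (cong (2 * (2 + m) ∸_) (trans φ≡t*2 (*-comm t 2))) (sym (*-distribˡ-∸ 2 (2 + m) t))

iter-suc : ∀ i n → iter (suc i) n ≡ iter i (g n)
iter-suc zero    n = refl
iter-suc (suc i) n = cong g (iter-suc i n)

IsC-1 : IsC 1 0
IsC-1 = refl , λ _ ()

IsC-g⁻¹ : ∀ {n c} → n ≢ 1 → IsC (g n) c → IsC n (suc c)
IsC-g⁻¹ {n} {c} n≢1 (gn-reaches , gn-not-before) = trans (iter-suc c n) gn-reaches , not-before
  where
  not-before : ∀ j → j < suc c → iter j n ≢ 1
  not-before zero    _         = n≢1
  not-before (suc j) (s≤s j<c) = gn-not-before j j<c ∘ trans (sym (iter-suc j n))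

IsC-g : ∀ {n c} → IsC n (suc c) → IsC (g n) c
IsC-g {n} {c} (n-reaches , n-not-before) =
  trans (sym (iter-suc c n)) n-reaches , λ j j<c → n-not-before (suc j) (s≤s j<c) ∘ trans (iter-suc j n)

IsC-unique : ∀ {n a b} → IsC n a → IsC n b → a ≡ b
IsC-unique {a = a} {b} (a-reaches , a-least) (b-reaches , b-least) with <-cmp a b
... | tri< a<b _ _ = contradiction a-reaches (b-least a a<b)
... | tri≈ _ a≡b _ = a≡b
... | tri> _ _ b<a = contradiction b-reaches (a-least b b<a)

IsC-suc⇒even : ∀ {y c} → OneOrEven y → IsC y (suc c) → ∃[ k ] y ≡ 2 * suc k
IsC-suc⇒even (inj₁ y≡1) (_ , not-before) = contradiction y≡1 (not-before 0 z<s)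
IsC-suc⇒even (inj₂ y≡2k) _ = y≡2k

IsC-2* : ∀ {m c} → OneOrEven m → IsC m c → IsC (2 * m) (suc c)
IsC-2* {c = zero}  _  (refl , _) = IsC-g⁻¹ (λ ()) IsC-1
IsC-2* {c = suc c} om C with IsC-suc⇒even om C
... | k , refl = IsC-g⁻¹ (2*≢1 (2 * suc k))
  (subst (λ x → IsC x (suc c)) (sym (g[2m]≡2g[m] (2 * suc k) (m∣m*n (suc k))))
         (IsC-2* (g-OneOrEven k) (IsC-g C)))

IsC-2 : IsC 2 1
IsC-2 = IsC-2* (inj₁ refl) IsC-1

IsC-2^* : ∀ h {y b} → OneOrEven y → IsC y b → IsC (2 ^ h * y) (b + h)
IsC-2^* zero    {y} {b} oy C = subst₂ IsC (sym (*-identityˡ y)) (sym (+-identityʳ b)) C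
IsC-2^* (suc h) {y} {b} oy C = subst₂ IsC (sym (2^suc-* h y)) (sym (+-suc b h))
  (IsC-2* (OneOrEven-2^* h oy) (IsC-2^* h oy C))

≤2^C : ∀ {n c} → OneOrEven n → IsC n c → n ≤ 2 ^ c
≤2^C {c = zero}  _  (n≡1 , _) = ≤-reflexive n≡1
≤2^C {c = suc c} on C with IsC-suc⇒even on C
... | k , refl = *-monoʳ-≤ 2 (≤-trans (m≤g[2m] (suc k)) (≤2^C (g-OneOrEven k) (IsC-g C)))

InS-scaled : ∀ {p y b} h → 1 ≤ p → OneOrEven y → IsC y b →
  2 ^ p ≤ 2 ^ h * y → 2 ^ h * y ≤ 2 ^ suc p → InS (suc p) (b + h)
InS-scaled h 1≤p oy C lo hi =
  _ , lo , hi , OneOrEven⇒even (OneOrEven-2^* h oy) (≤-trans (^-monoʳ-≤ 2 1≤p) lo) , IsC-2^* h oy C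

InS-min : ∀ {p} → 1 ≤ p → InS (suc p) p
InS-min {p} 1≤p = InS-scaled p 1≤p (inj₁ refl) IsC-1
  (≤-reflexive (sym (*-identityʳ (2 ^ p))))
  (≤-trans (≤-reflexive (*-identityʳ (2 ^ p))) (m≤m+n (2 ^ p) (2 ^ p + 0)))

InS-lower : ∀ {p c} → InS (suc p) c → p ≤ c
InS-lower {p} (n , lo , _ , (k , n≡2k) , C) =
  2^-cancel-≤ (≤-trans lo (≤2^C (even⇒OneOrEven k n≡2k (≤-trans (m^n>0 2 p) lo)) C))

InS-between : ∀ {p} b {y} h {c} → 1 ≤ p → OneOrEven y → IsC y b →
  2 ^ p ≤ 2 ^ h * y → 2 ^ h * y ≤ 2 ^ suc p → p ≤ c → c ≤ b + h → InS (suc p) c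
InS-between b h {c} 1≤p oy C lo hi p≤c c≤b+h with c ≟ b + h
... | yes refl = InS-scaled h 1≤p oy C lo hi
InS-between {p} zero h {c} 1≤p oy (refl , _) lo hi p≤c c≤h | no c≢h =
  subst (InS (suc p)) (≤-antisym p≤c c≤p) (InS-min 1≤p)
  where
  c≤p : c ≤ p
  c≤p = ≤-pred (≤-trans (≤∧≢⇒< c≤h c≢h) (2^-cancel-≤ (subst (_≤ 2 ^ suc p) (*-identityʳ (2 ^ h)) hi)))
InS-between {p} (suc b) h {c} 1≤p oy C lo hi p≤c c≤b+h | no c≢b+h with IsC-suc⇒even oy C
... | k , refl with 2 ^ p ≤? 2 ^ h * g (2 * suc k)
...   | yes lo′ = InS-between b h 1≤p (g-OneOrEven k) (IsC-g C) lo′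
  (≤-trans (*-monoʳ-≤ (2 ^ h) (<⇒≤ (g[2m]<2m k))) hi) p≤c (≤-pred (≤∧≢⇒< c≤b+h c≢b+h))
...   | no  ¬lo′ = InS-between b (suc h) 1≤p (g-OneOrEven k) (IsC-g C) lo″ hi″ p≤c
  (subst (c ≤_) (sym (+-suc b h)) c≤b+h)
  where
  z : ℕ
  z = g (2 * suc k)
  lo″ : 2 ^ p ≤ 2 ^ suc h * z
  lo″ = ≤-trans lo (subst (2 ^ h * (2 * suc k) ≤_) (m*[2*n]≡2*m*n (2 ^ h) z)
                          (*-monoʳ-≤ (2 ^ h) (*-monoʳ-≤ 2 (m≤g[2m] (suc k)))))
  hi″ : 2 ^ suc h * z ≤ 2 ^ suc p
  hi″ = subst (_≤ 2 ^ suc p) (sym (2^suc-* h z)) (<⇒≤ (*-monoʳ-< 2 (≰⇒> ¬lo′)))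

InS-downward-closed : ∀ {p b c} → 1 ≤ p → InS (suc p) b → p ≤ c → c ≤ b → InS (suc p) c
InS-downward-closed {p} {b} 1≤p (x , lo , hi , (k , x≡2k) , C) p≤c c≤b =
  InS-between b 0 1≤p (even⇒OneOrEven k x≡2k (≤-trans (m^n>0 2 p) lo)) C
    (subst (2 ^ p ≤_) (sym (*-identityˡ x)) lo) (subst (_≤ 2 ^ suc p) (sym (*-identityˡ x)) hi)
    p≤c (subst (_ ≤_) (sym (+-identityʳ b)) c≤b)

InS-1 : ∀ {m} → InS 1 m → m ≡ 1
InS-1 (suc zero , _ , _ , (k , 1≡2k) , _) = contradiction (sym 1≡2k) (2*≢1 k)
InS-1 (suc (suc zero) , _ , _ , _ , C)    = IsC-unique C IsC-2
InS-1 (suc (suc (suc _)) , _ , s≤s (s≤s ()) , _)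

mainTheorem4 : ∀ (i : ℕ) → 1 ≤ i → IsInterval (InS i)
mainTheorem4 (suc zero) _ a b c a∈S b∈S a≤c c≤b =
  subst (InS 1) (≤-antisym (subst (_≤ c) (InS-1 a∈S) a≤c) (subst (c ≤_) (InS-1 b∈S) c≤b))
        (2 , s≤s z≤n , ≤-refl , (1 , refl) , IsC-2)
mainTheorem4 (suc p@(suc _)) _ a b c a∈S b∈S a≤c c≤b =
  InS-downward-closed (s≤s z≤n) b∈S (≤-trans (InS-lower {p} a∈S) a≤c) c≤b
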